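{- For every finite set (sequent) $\Phi\subseteq\mathcal{L}_{NF}$: if $\mathsf{G}\vdash\Phi$ then $\mathsf{Full}\vdash\bigvee\Phi$. Consequently, for all $\xi\in\mathcal{L}_{NF}$, if $\mathsf{G}\vdash\xi$ then $\mathsf{Full}\vdash\xi$.
   Context: Fix countable $\mathsf{P}_0$, $\mathsf{G}_0$. $\mathcal{L}_{NF}$: $\varphi ::= p \mid \neg p \mid \varphi\lor\varphi \mid \varphi\land\varphi \mid \langle\gamma\rangle\varphi$, $\gamma ::= g \mid g^d \mid \gamma;\gamma \mid \gamma\sqcup\gamma \mid \gamma\sqcap\gamma \mid \gamma^* \mid \gamma^\times \mid \varphi? \mid \varphi!$. $\mathcal{L}_{Full}$: $\varphi ::= p \mid \neg\varphi \mid \varphi\lor\varphi \mid \langle\gamma\rangle\varphi$, $\gamma ::= g \mid \gamma;\gamma \mid \gamma\sqcup\gamma \mid \gamma\sqcap\gamma \mid \gamma^* \mid \gamma^\times \mid \gamma^d \mid \varphi? \mid \varphi!$ with $\land,\to,\leftrightarrow$ abbreviations, so $\mathcal{L}_{NF}\subseteq\mathcal{L}_{Full}$. $\mathsf{Full}$: Hilbert system over $\mathcal{L}_{Full}$ with axioms: propositional tautologies; $\langle\gamma;\delta\rangle\varphi\leftrightarrow\langle\gamma\rangle\langle\delta\rangle\varphi$; $\langle\gamma\sqcup\delta\rangle\varphi\leftrightarrow\langle\gamma\rangle\varphi\lor\langle\delta\rangle\varphi$; $\langle\gamma^*\rangle\varphi\leftrightarrow\varphi\lor\langle\gamma\rangle\langle\gamma^*\rangle\varphi$;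 $\langle\psi?\rangle\varphi\leftrightarrow\psi\land\varphi$; $\langle\gamma^d\rangle\varphi\leftrightarrow\neg\langle\gamma\rangle\neg\varphi$; $\langle\gamma\sqcap\delta\rangle\varphi\leftrightarrow\langle\gamma\rangle\varphi\land\langle\delta\rangle\varphi$; $\langle\gamma^\times\rangle\varphi\leftrightarrow\varphi\land\langle\gamma\rangle\langle\gamma^\times\rangle\varphi$; $\langle\psi!\rangle\varphi\leftrightarrow\psi\lor\varphi$; rules: modus ponens; from $\varphi\to\psi$ infer $\langle\gamma\rangle\varphi\to\langle\gamma\rangle\psi$; from $\langle\gamma\rangle\varphi\to\varphi$ infer $\langle\gamma^*\rangle\varphi\to\varphi$; from $\varphi\to\langle\gamma\rangle\varphi$ infer $\varphi\to\langle\gamma^\times\rangle\varphi$. Complement on $\mathcal{L}_{NF}$: $\overline p=\neg p$, $\overline{\neg p}=p$, $\overline{\varphi\lor\psi}=\overline\varphi\land\overline\psi$, $\overline{\varphi\land\psi}=\overline\varphi\lor\overline\psi$, $\overline{\langle\gamma\rangle\varphi}=\langle\check\gamma\rangle\overline\varphi$; $\check g=g^d$, $\check{(g^d)}=g$, $\check{(\gamma;\delta)}=\check\gamma;\check\delta$, $\check{(\gamma\sqcup\delta)}=\check\gamma\sqcap\check\delta$, $\check{(\gamma\sqcap\delta)}=\check\gamma\sqcup\check\delta$, $\check{(\gamma^*)}=(\check\gamma)^\times$, $\check{(\gamma^\times)}=(\check\gamma)^*$, $\check{(\varphi?)}=\overline\varphi!$, $\check{(\varphi!)}=\overline\varphi?$;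 for finite $\Phi=\{\varphi_1,\dots,\varphi_n\}$, $\overline\Phi=\overline{\varphi_1}\land\dots\land\overline{\varphi_n}$. $\mathsf{G}$: sequents are finite sets of $\mathcal{L}_{NF}$-formulas; rules: axiom $\Phi,\overline\Phi$; $\Phi/\Phi,\varphi$; $\varphi,\psi/\langle g\rangle\varphi,\langle g^d\rangle\psi$; $\Phi,\varphi,\psi/\Phi,\varphi\lor\psi$; $\Phi,\varphi$ and $\Phi,\psi/\Phi,\varphi\land\psi$; $\Phi,\varphi\lor\langle\gamma\rangle\langle\gamma^*\rangle\varphi/\Phi,\langle\gamma^*\rangle\varphi$; $\Phi,\varphi\land\langle\gamma\rangle\langle\gamma^\times\rangle\varphi/\Phi,\langle\gamma^\times\rangle\varphi$; $\Phi,\langle\gamma\rangle\varphi\lor\langle\delta\rangle\varphi/\Phi,\langle\gamma\sqcup\delta\rangle\varphi$; $\Phi,\langle\gamma\rangle\varphi\land\langle\delta\rangle\varphi/\Phi,\langle\gamma\sqcap\delta\rangle\varphi$; $\Phi,\psi\land\varphi/\Phi,\langle\psi?\rangle\varphi$; $\Phi,\psi\lor\varphi/\Phi,\langle\psi!\rangle\varphi$; deep rules ($\psi(\cdot)$ a formula with a unique placeholder occurrence of formula or game sort): $\Phi,\psi(\gamma)/\Phi,\psi(\chi!;\gamma)$, $\Phi,\psi(\varphi)/\Phi,\psi(\langle\chi!\rangle\varphi)$, $\Phi,\psi(\langle\gamma\rangle\langle\delta\rangle\varphi)/\Phi,\psi(\langle\gamma;\delta\rangle\varphi)$; and $\Phi,\varphi\land\langle\gamma\rangle\langle(\overline\Phi!;\gamma)^\times\rangle\langle\overline\Phi!\rangle\varphi/\Phi,\langle\gamma^\times\rangle\varphi$.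 $\mathsf{G}\vdash\Phi$: finite derivation of $\Phi$ whose leaves are axioms. -}

module Defs where

open import Data.Nat using (ℕ)
open import Data.Bool using (Bool; true; false; not; _∨_)
open import Data.List using (List; []; _∷_; _++_)
open import Data.List.Membership.Propositional using (_∈_)
open import Data.Product using (_×_)
open import Relation.Binary.PropositionalEquality using (_≡_)

data Sort : Set where
  fm gm : Sort

infixr 6 _∨ₙ_
infixr 7 _∧ₙ_
infixr 5 _⨾ₙ_

data NF : Sort → Set where
  pos    : ℕ → NF fm
  neg    : ℕ → NF fm
  _∨ₙ_   : NF fm → NF fm → NF fm
  _∧ₙ_   : NF fm → NF fm → NF fm
  ⟨_⟩ₙ_  : NF gm → NF fm → NF fm
  atg    : ℕ → NF gm
  datg   : ℕ → NF gm
  _⨾ₙ_   : NF gm → NF gm → NF gm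
  _⊔ₙ_   : NF gm → NF gm → NF gm
  _⊓ₙ_   : NF gm → NF gm → NF gm
  starₙ  : NF gm → NF gm
  crossₙ : NF gm → NF gm
  testₙ  : NF fm → NF gm
  bangₙ  : NF fm → NF gm

NFForm : Set
NFForm = NF fm

NFGame : Set
NFGame = NF gm

comp : ∀ {s} → NF s → NF s
comp (pos p)     = neg p
comp (neg p)     = pos p
comp (φ ∨ₙ ψ)    = comp φ ∧ₙ comp ψ
comp (φ ∧ₙ ψ)    = comp φ ∨ₙ comp ψ
comp (⟨ γ ⟩ₙ φ)  = ⟨ comp γ ⟩ₙ comp φ
comp (atg g)     = datg g
comp (datg g)    = atg g
comp (γ ⨾ₙ δ)    = comp γ ⨾ₙ comp δ
comp (γ ⊔ₙ δ)    = comp γ ⊓ₙ comp δ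
comp (γ ⊓ₙ δ)    = comp γ ⊔ₙ comp δ
comp (starₙ γ)   = crossₙ (comp γ)
comp (crossₙ γ)  = starₙ (comp γ)
comp (testₙ φ)   = bangₙ (comp φ)
comp (bangₙ φ)   = testₙ (comp φ)

-- Truth constant used only for the empty conjunction
⊤ₙ : NFForm
⊤ₙ = pos 0 ∨ₙ neg 0

compSeq : List NFForm → NFForm
compSeq []           = ⊤ₙ
compSeq (φ ∷ [])     = comp φ
compSeq (φ ∷ ψ ∷ Φ)  = comp φ ∧ₙ compSeq (ψ ∷ Φ)

-- One-hole contexts ψ(·): an expression of sort t with a unique
-- placeholder of sort h.

data Ctx (h : Sort) : Sort → Set where
  hole    : Ctx h h
  ∨L      : Ctx h fm → NF fm → Ctx h fm
  ∨R      : NF fm → Ctx h fm → Ctx h fm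
  ∧L      : Ctx h fm → NF fm → Ctx h fm
  ∧R      : NF fm → Ctx h fm → Ctx h fm
  ⟨⟩G     : Ctx h gm → NF fm → Ctx h fm
  ⟨⟩F     : NF gm → Ctx h fm → Ctx h fm
  ⨾L      : Ctx h gm → NF gm → Ctx h gm
  ⨾R      : NF gm → Ctx h gm → Ctx h gm
  ⊔L      : Ctx h gm → NF gm → Ctx h gm
  ⊔R      : NF gm → Ctx h gm → Ctx h gm
  ⊓L      : Ctx h gm → NF gm → Ctx h gm
  ⊓R      : NF gm → Ctx h gm → Ctx h gm
  starC   : Ctx h gm → Ctx h gm
  crossC  : Ctx h gm → Ctx h gm
  testC   : Ctx h fm → Ctx h gm
  bangC   : Ctx h fm → Ctx h gm

plug : ∀ {h t} → Ctx h t → NF h → NF t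
plug hole        e = e
plug (∨L c ψ)    e = plug c e ∨ₙ ψ
plug (∨R φ c)    e = φ ∨ₙ plug c e
plug (∧L c ψ)    e = plug c e ∧ₙ ψ
plug (∧R φ c)    e = φ ∧ₙ plug c e
plug (⟨⟩G c φ)   e = ⟨ plug c e ⟩ₙ φ
plug (⟨⟩F γ c)   e = ⟨ γ ⟩ₙ plug c e
plug (⨾L c δ)    e = plug c e ⨾ₙ δ
plug (⨾R γ c)    e = γ ⨾ₙ plug c e
plug (⊔L c δ)    e = plug c e ⊔ₙ δ
plug (⊔R γ c)    e = γ ⊔ₙ plug c e
plug (⊓L c δ)    e = plug c e ⊓ₙ δ
plug (⊓R γ c)    e = γ ⊓ₙ plug c e
plug (starC c)   e = starₙ (plug c e)
plug (crossC c)  e = crossₙ (plug c e)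
plug (testC c)   e = testₙ (plug c e)
plug (bangC c)   e = bangₙ (plug c e)

-- Sequents: finite sets of L_NF formulas, represented by lists taken
-- up to having the same elements.

Sequent : Set
Sequent = List NFForm

_≈ₛ_ : Sequent → Sequent → Set
Φ ≈ₛ Ψ = (∀ φ → φ ∈ Φ → φ ∈ Ψ) × (∀ φ → φ ∈ Ψ → φ ∈ Φ)

_,,_ : Sequent → NFForm → Sequent
Φ ,, φ = Φ ++ (φ ∷ [])

infixl 4 _,,_

data G⊢ : Sequent → Set where
  set-eq   : ∀ {Φ Ψ} → G⊢ Φ → Φ ≈ₛ Ψ → G⊢ Ψ
  ax       : ∀ Φ → G⊢ (Φ ,, compSeq Φ)
  weak     : ∀ {Φ} φ → G⊢ Φ → G⊢ (Φ ,, φ)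
  modal    : ∀ g {φ ψ} → G⊢ (φ ∷ ψ ∷ []) →
             G⊢ (⟨ atg g ⟩ₙ φ ∷ ⟨ datg g ⟩ₙ ψ ∷ [])
  or-r     : ∀ {Φ φ ψ} → G⊢ (Φ ,, φ ,, ψ) → G⊢ (Φ ,, (φ ∨ₙ ψ))
  and-r    : ∀ {Φ φ ψ} → G⊢ (Φ ,, φ) → G⊢ (Φ ,, ψ) → G⊢ (Φ ,, (φ ∧ₙ ψ))
  star-r   : ∀ {Φ γ φ} → G⊢ (Φ ,, (φ ∨ₙ ⟨ γ ⟩ₙ ⟨ starₙ γ ⟩ₙ φ)) →
             G⊢ (Φ ,, ⟨ starₙ γ ⟩ₙ φ)
  cross-r  : ∀ {Φ γ φ} → G⊢ (Φ ,, (φ ∧ₙ ⟨ γ ⟩ₙ ⟨ crossₙ γ ⟩ₙ φ)) →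
             G⊢ (Φ ,, ⟨ crossₙ γ ⟩ₙ φ)
  cup-r    : ∀ {Φ γ δ φ} → G⊢ (Φ ,, (⟨ γ ⟩ₙ φ ∨ₙ ⟨ δ ⟩ₙ φ)) →
             G⊢ (Φ ,, ⟨ γ ⊔ₙ δ ⟩ₙ φ)
  cap-r    : ∀ {Φ γ δ φ} → G⊢ (Φ ,, (⟨ γ ⟩ₙ φ ∧ₙ ⟨ δ ⟩ₙ φ)) →
             G⊢ (Φ ,, ⟨ γ ⊓ₙ δ ⟩ₙ φ)
  test-r   : ∀ {Φ ψ φ} → G⊢ (Φ ,, (ψ ∧ₙ φ)) → G⊢ (Φ ,, ⟨ testₙ ψ ⟩ₙ φ)
  bang-r   : ∀ {Φ ψ φ} → G⊢ (Φ ,, (ψ ∨ₙ φ)) → G⊢ (Φ ,, ⟨ bangₙ ψ ⟩ₙ φ)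
  deep-bang-g : ∀ {Φ} (c : Ctx gm fm) χ γ →
             G⊢ (Φ ,, plug c γ) → G⊢ (Φ ,, plug c (bangₙ χ ⨾ₙ γ))
  deep-bang-f : ∀ {Φ} (c : Ctx fm fm) χ φ →
             G⊢ (Φ ,, plug c φ) → G⊢ (Φ ,, plug c (⟨ bangₙ χ ⟩ₙ φ))
  deep-seq : ∀ {Φ} (c : Ctx fm fm) γ δ φ →
             G⊢ (Φ ,, plug c (⟨ γ ⟩ₙ ⟨ δ ⟩ₙ φ)) →
             G⊢ (Φ ,, plug c (⟨ γ ⨾ₙ δ ⟩ₙ φ))
  cross-focus : ∀ {Φ γ φ} →
             G⊢ (Φ ,, (φ ∧ₙ ⟨ γ ⟩ₙ ⟨ crossₙ (bangₙ (compSeq Φ) ⨾ₙ γ) ⟩ₙ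
                                     ⟨ bangₙ (compSeq Φ) ⟩ₙ φ)) →
             G⊢ (Φ ,, ⟨ crossₙ γ ⟩ₙ φ)

infixr 6 _∨f_
infixr 5 _⨾f_

data FFm : Set
data FGm : Set

data FFm where
  var   : ℕ → FFm
  ¬f_   : FFm → FFm
  _∨f_  : FFm → FFm → FFm
  ⟨_⟩f_ : FGm → FFm → FFm

data FGm where
  gat    : ℕ → FGm
  _⨾f_   : FGm → FGm → FGm
  _⊔f_   : FGm → FGm → FGm
  _⊓f_   : FGm → FGm → FGm
  _*f    : FGm → FGm
  _×f    : FGm → FGm
  _ᵈf    : FGm → FGm
  _?f    : FFm → FGm
  _!f    : FFm → FGm

infixr 7 _∧f_
infixr 4 _⇒f_ _⇔f_

_∧f_ : FFm → FFm → FFm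
φ ∧f ψ = ¬f (¬f φ ∨f ¬f ψ)

_⇒f_ : FFm → FFm → FFm
φ ⇒f ψ = ¬f φ ∨f ψ

_⇔f_ : FFm → FFm → FFm
φ ⇔f ψ = (φ ⇒f ψ) ∧f (ψ ⇒f φ)

⊥f : FFm
⊥f = ¬f (var 0 ∨f ¬f var 0)

-- propositional tautologies: true under every Boolean valuation that
-- treats atoms p and modal formulas ⟨γ⟩φ as propositional atoms
evalT : (FFm → Bool) → FFm → Bool
evalT v (var p)     = v (var p)
evalT v (¬f φ)      = not (evalT v φ)
evalT v (φ ∨f ψ)    = evalT v φ ∨ evalT v ψ
evalT v (⟨ γ ⟩f φ)  = v (⟨ γ ⟩f φ)

Tautology : FFm → Set
Tautology φ = ∀ (v : FFm → Bool) → evalT v φ ≡ true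

data Full⊢ : FFm → Set where
  taut   : ∀ {φ} → Tautology φ → Full⊢ φ
  ax-seq : ∀ γ δ φ → Full⊢ (⟨ γ ⨾f δ ⟩f φ ⇔f ⟨ γ ⟩f ⟨ δ ⟩f φ)
  ax-cup : ∀ γ δ φ → Full⊢ (⟨ γ ⊔f δ ⟩f φ ⇔f (⟨ γ ⟩f φ ∨f ⟨ δ ⟩f φ))
  ax-star : ∀ γ φ → Full⊢ (⟨ γ *f ⟩f φ ⇔f (φ ∨f ⟨ γ ⟩f ⟨ γ *f ⟩f φ))
  ax-test : ∀ ψ φ → Full⊢ (⟨ ψ ?f ⟩f φ ⇔f (ψ ∧f φ))
  ax-dual : ∀ γ φ → Full⊢ (⟨ γ ᵈf ⟩f φ ⇔f ¬f ⟨ γ ⟩f ¬f φ)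
  ax-cap : ∀ γ δ φ → Full⊢ (⟨ γ ⊓f δ ⟩f φ ⇔f (⟨ γ ⟩f φ ∧f ⟨ δ ⟩f φ))
  ax-cross : ∀ γ φ → Full⊢ (⟨ γ ×f ⟩f φ ⇔f (φ ∧f ⟨ γ ⟩f ⟨ γ ×f ⟩f φ))
  ax-bang : ∀ ψ φ → Full⊢ (⟨ ψ !f ⟩f φ ⇔f (ψ ∨f φ))
  mp     : ∀ {φ ψ} → Full⊢ (φ ⇒f ψ) → Full⊢ φ → Full⊢ ψ
  mono   : ∀ {φ ψ} γ → Full⊢ (φ ⇒f ψ) → Full⊢ (⟨ γ ⟩f φ ⇒f ⟨ γ ⟩f ψ)
  star-ind : ∀ {γ φ} → Full⊢ (⟨ γ ⟩f φ ⇒f φ) → Full⊢ (⟨ γ *f ⟩f φ ⇒f φ)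
  cross-coind : ∀ {γ φ} → Full⊢ (φ ⇒f ⟨ γ ⟩f φ) → Full⊢ (φ ⇒f ⟨ γ ×f ⟩f φ)

embF : NF fm → FFm
embG : NF gm → FGm
embF (pos p)    = var p
embF (neg p)    = ¬f var p
embF (φ ∨ₙ ψ)   = embF φ ∨f embF ψ
embF (φ ∧ₙ ψ)   = embF φ ∧f embF ψ
embF (⟨ γ ⟩ₙ φ) = ⟨ embG γ ⟩f embF φ
embG (atg g)    = gat g
embG (datg g)   = gat g ᵈf
embG (γ ⨾ₙ δ)   = embG γ ⨾f embG δ
embG (γ ⊔ₙ δ)   = embG γ ⊔f embG δ
embG (γ ⊓ₙ δ)   = embG γ ⊓f embG δ
embG (starₙ γ)  = embG γ *f
embG (crossₙ γ) = embG γ ×f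
embG (testₙ φ)  = embF φ ?f
embG (bangₙ φ)  = embF φ !f

⋁ : Sequent → FFm
⋁ []           = ⊥f
⋁ (φ ∷ [])     = embF φ
⋁ (φ ∷ ψ ∷ Φ)  = embF φ ∨f ⋁ (ψ ∷ Φ)

-- Soundness is proved rule by rule, reading a sequent Φ, φ as the implication Φ̄ → φ.  The complement of a formula is provably its negation,
-- and that of a game its dual; star and cross are exchanged by the induction and
-- coinduction rules.  Every operator of Full is monotone, so each deep rule reduces to a
-- valid implication plugged into a context.  For the focusing rule, under its premise
-- X = ⟨(Φ̄!;γ)^×⟩⟨Φ̄!⟩φ is a post-fixpoint of ⟨γ⟩ implying φ and implied by Φ̄, so
-- coinduction gives Φ̄ → ⟨γ^×⟩φ.  All propositional glue consists of instances of
-- tautologies, verified by truth tables.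
module Submission where

open import Defs
open import Data.Bool using (Bool; true; false; not; _∨_; T; _≟_)
open import Data.Bool.Properties using (T-≡; T-∨)
open import Data.Empty using (⊥-elim)
open import Data.Fin using (Fin; #_)
open import Data.List using ([]; _∷_)
open import Data.List.Relation.Unary.Any using (Any; here; there)
open import Data.List.Relation.Binary.Subset.Propositional using (_⊆_)
open import Data.List.Relation.Binary.Subset.Propositional.Properties using (Any-resp-⊆)
open import Data.Nat using (ℕ; zero; suc; _+_)
open import Data.Product using (_×_; _,_)
open import Data.Sum using ([_,_]′; inj₁; inj₂)
open import Data.Vec using (Vec; []; _∷_; lookup; map)
open import Data.Vec.Properties using (lookup-map)
open import Function using (_∘_; _$_)
open import Function.Bundles using (_⇔_; mk⇔; Equivalence)
open import Relation.Binary.PropositionalEquality using (_≡_; refl; sym; trans)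
open import Relation.Nullary.Decidable using (Dec; True; toWitness; map′; _×-dec_)

open Equivalence using (to; from)

-- Propositional tautologies

infixr 4 _⇒ₜ_ _⇔ₜ_
infixr 6 _∨ₜ_
infixr 7 _∧ₜ_
infix 8 ¬ₜ_

data Template (n : ℕ) : Set where
  atom  : Fin n → Template n
  ¬ₜ_   : Template n → Template n
  _∨ₜ_  : Template n → Template n → Template n

_∧ₜ_ _⇒ₜ_ _⇔ₜ_ : ∀ {n} → Template n → Template n → Template n
s ∧ₜ t = ¬ₜ (¬ₜ s ∨ₜ ¬ₜ t)
s ⇒ₜ t = ¬ₜ s ∨ₜ t
s ⇔ₜ t = (s ⇒ₜ t) ∧ₜ (t ⇒ₜ s)

p₀ : ∀ {n} → Template (1 + n)
p₀ = atom (# 0)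
p₁ : ∀ {n} → Template (2 + n)
p₁ = atom (# 1)
p₂ : ∀ {n} → Template (3 + n)
p₂ = atom (# 2)
p₃ : ∀ {n} → Template (4 + n)
p₃ = atom (# 3)
p₄ : ∀ {n} → Template (5 + n)
p₄ = atom (# 4)
p₅ : ∀ {n} → Template (6 + n)
p₅ = atom (# 5)
p₆ : ∀ {n} → Template (7 + n)
p₆ = atom (# 6)

instantiate : ∀ {n} → Template n → Vec FFm n → FFm
instantiate (atom i) σ = lookup σ i
instantiate (¬ₜ t)   σ = ¬f instantiate t σ
instantiate (s ∨ₜ t) σ = instantiate s σ ∨f instantiate t σ

truthValue : ∀ {n} → Template n → Vec Bool n → Bool
truthValue (atom i) ρ = lookup ρ i
truthValue (¬ₜ t)   ρ = not (truthValue t ρ)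
truthValue (s ∨ₜ t) ρ = truthValue s ρ ∨ truthValue t ρ

evalT-instantiate : ∀ {n} v (t : Template n) σ →
                    evalT v (instantiate t σ) ≡ truthValue t (map (evalT v) σ)
evalT-instantiate v (atom i) σ = sym (lookup-map i (evalT v) σ)
evalT-instantiate v (¬ₜ t)   σ rewrite evalT-instantiate v t σ = refl
evalT-instantiate v (s ∨ₜ t) σ rewrite evalT-instantiate v s σ | evalT-instantiate v t σ = refl

valid? : ∀ n (f : Vec Bool n → Bool) → Dec (∀ ρ → f ρ ≡ true)
valid? zero f = map′ everywhere (_$ []) (f [] ≟ true)
  where
  everywhere : f [] ≡ true → ∀ ρ → f ρ ≡ true
  everywhere f[]≡true [] = f[]≡true
valid? (suc n) f =
  map′ join split (valid? n (f ∘ (true ∷_)) ×-dec valid? n (f ∘ (false ∷_)))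
  where
  join : (∀ ρ → f (true ∷ ρ) ≡ true) × (∀ ρ → f (false ∷ ρ) ≡ true) → ∀ ρ → f ρ ≡ true
  join (onTrue , _) (true ∷ ρ)  = onTrue ρ
  join (_ , onFalse) (false ∷ ρ) = onFalse ρ
  split : (∀ ρ → f ρ ≡ true) → (∀ ρ → f (true ∷ ρ) ≡ true) × (∀ ρ → f (false ∷ ρ) ≡ true)
  split valid = valid ∘ (true ∷_) , valid ∘ (false ∷_)

-- The truth table is checked by normalisation, when Agda solves the implicit argument.
tauto : ∀ {n} (t : Template n) (σ : Vec FFm n) →
        {True (valid? n (truthValue t))} → Full⊢ (instantiate t σ)
tauto {n} t σ {valid} =
  taut λ v → trans (evalT-instantiate v t σ) (toWitness valid (map (evalT v) σ))

infixl 3 _⊙_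
_⊙_ : ∀ {φ ψ} → Full⊢ (φ ⇒f ψ) → Full⊢ φ → Full⊢ ψ
_⊙_ = mp

⇒-refl : ∀ {a} → Full⊢ (a ⇒f a)
⇒-refl {a} = tauto (p₀ ⇒ₜ p₀) (a ∷ [])

⇒-trans : ∀ {a b c} → Full⊢ (a ⇒f b) → Full⊢ (b ⇒f c) → Full⊢ (a ⇒f c)
⇒-trans {a} {b} {c} a⇒b b⇒c =
  tauto ((p₀ ⇒ₜ p₁) ⇒ₜ (p₁ ⇒ₜ p₂) ⇒ₜ p₀ ⇒ₜ p₂) (a ∷ b ∷ c ∷ []) ⊙ a⇒b ⊙ b⇒c

⇔-intro : ∀ {a b} → Full⊢ (a ⇒f b) → Full⊢ (b ⇒f a) → Full⊢ (a ⇔f b)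
⇔-intro {a} {b} a⇒b b⇒a =
  tauto ((p₀ ⇒ₜ p₁) ⇒ₜ (p₁ ⇒ₜ p₀) ⇒ₜ (p₀ ⇔ₜ p₁)) (a ∷ b ∷ []) ⊙ a⇒b ⊙ b⇒a

⇔-to : ∀ {a b} → Full⊢ (a ⇔f b) → Full⊢ (a ⇒f b)
⇔-to {a} {b} a⇔b = tauto ((p₀ ⇔ₜ p₁) ⇒ₜ p₀ ⇒ₜ p₁) (a ∷ b ∷ []) ⊙ a⇔b

⇔-from : ∀ {a b} → Full⊢ (a ⇔f b) → Full⊢ (b ⇒f a)
⇔-from {a} {b} a⇔b = tauto ((p₀ ⇔ₜ p₁) ⇒ₜ p₁ ⇒ₜ p₀) (a ∷ b ∷ []) ⊙ a⇔b

⇒-resp-⇔ : ∀ {a a′ b b′} → Full⊢ (a ⇔f a′) → Full⊢ (b ⇔f b′) →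
           Full⊢ (a′ ⇒f b′) → Full⊢ (a ⇒f b)
⇒-resp-⇔ a⇔a′ b⇔b′ a′⇒b′ = ⇒-trans (⇔-to a⇔a′) (⇒-trans a′⇒b′ (⇔-from b⇔b′))

∨-mono : ∀ {a a′ b b′} → Full⊢ (a ⇒f a′) → Full⊢ (b ⇒f b′) → Full⊢ (a ∨f b ⇒f a′ ∨f b′)
∨-mono {a} {a′} {b} {b′} a⇒a′ b⇒b′ =
  tauto ((p₀ ⇒ₜ p₁) ⇒ₜ (p₂ ⇒ₜ p₃) ⇒ₜ (p₀ ∨ₜ p₂ ⇒ₜ p₁ ∨ₜ p₃)) (a ∷ a′ ∷ b ∷ b′ ∷ [])
    ⊙ a⇒a′ ⊙ b⇒b′

∧-mono : ∀ {a a′ b b′} → Full⊢ (a ⇒f a′) → Full⊢ (b ⇒f b′) → Full⊢ (a ∧f b ⇒f a′ ∧f b′)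
∧-mono {a} {a′} {b} {b′} a⇒a′ b⇒b′ =
  tauto ((p₀ ⇒ₜ p₁) ⇒ₜ (p₂ ⇒ₜ p₃) ⇒ₜ (p₀ ∧ₜ p₂ ⇒ₜ p₁ ∧ₜ p₃)) (a ∷ a′ ∷ b ∷ b′ ∷ [])
    ⊙ a⇒a′ ⊙ b⇒b′

⟨⟩-cong : ∀ γ {a b} → Full⊢ (a ⇔f b) → Full⊢ (⟨ γ ⟩f a ⇔f ⟨ γ ⟩f b)
⟨⟩-cong γ a⇔b = ⇔-intro (mono γ (⇔-to a⇔b)) (mono γ (⇔-from a⇔b))

¬¬-elim : ∀ a → Full⊢ (¬f ¬f a ⇔f a)
¬¬-elim a = tauto (¬ₜ ¬ₜ p₀ ⇔ₜ p₀) (a ∷ [])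

-- Duality

Dual : FGm → FGm → Set
Dual Γ′ Γ = ∀ ψ → Full⊢ (⟨ Γ′ ⟩f ψ ⇔f ¬f ⟨ Γ ⟩f ¬f ψ)

dual-sym : ∀ {Γ′ Γ} → Dual Γ′ Γ → Dual Γ Γ′
dual-sym {Γ′} {Γ} dual ψ =
  tauto ((p₀ ⇔ₜ ¬ₜ p₁) ⇒ₜ (p₁ ⇔ₜ p₂) ⇒ₜ (p₂ ⇔ₜ ¬ₜ p₀))
        (⟨ Γ′ ⟩f ¬f ψ ∷ ⟨ Γ ⟩f ¬f ¬f ψ ∷ ⟨ Γ ⟩f ψ ∷ [])
    ⊙ dual (¬f ψ) ⊙ ⟨⟩-cong Γ (¬¬-elim ψ)

dual-⨾ : ∀ {Γ′ Γ Δ′ Δ} → Dual Γ′ Γ → Dual Δ′ Δ → Dual (Γ′ ⨾f Δ′) (Γ ⨾f Δ)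
dual-⨾ {Γ′} {Γ} {Δ′} {Δ} dualΓ dualΔ ψ =
  tauto ((p₀ ⇔ₜ p₁) ⇒ₜ (p₁ ⇔ₜ p₂) ⇒ₜ (p₂ ⇔ₜ ¬ₜ p₃) ⇒ₜ (p₃ ⇔ₜ p₄) ⇒ₜ (p₅ ⇔ₜ p₄)
           ⇒ₜ (p₀ ⇔ₜ ¬ₜ p₅))
        (⟨ Γ′ ⨾f Δ′ ⟩f ψ ∷ ⟨ Γ′ ⟩f ⟨ Δ′ ⟩f ψ ∷ ⟨ Γ′ ⟩f ¬f ⟨ Δ ⟩f ¬f ψ
          ∷ ⟨ Γ ⟩f ¬f ¬f ⟨ Δ ⟩f ¬f ψ ∷ ⟨ Γ ⟩f ⟨ Δ ⟩f ¬f ψ ∷ ⟨ Γ ⨾f Δ ⟩f ¬f ψ ∷ [])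
    ⊙ ax-seq Γ′ Δ′ ψ ⊙ ⟨⟩-cong Γ′ (dualΔ ψ) ⊙ dualΓ (¬f ⟨ Δ ⟩f ¬f ψ)
    ⊙ ⟨⟩-cong Γ (¬¬-elim (⟨ Δ ⟩f ¬f ψ)) ⊙ ax-seq Γ Δ (¬f ψ)

dual-⊓⊔ : ∀ {Γ′ Γ Δ′ Δ} → Dual Γ′ Γ → Dual Δ′ Δ → Dual (Γ′ ⊓f Δ′) (Γ ⊔f Δ)
dual-⊓⊔ {Γ′} {Γ} {Δ′} {Δ} dualΓ dualΔ ψ =
  tauto ((p₀ ⇔ₜ p₁ ∧ₜ p₂) ⇒ₜ (p₁ ⇔ₜ ¬ₜ p₃) ⇒ₜ (p₂ ⇔ₜ ¬ₜ p₄) ⇒ₜ (p₅ ⇔ₜ p₃ ∨ₜ p₄)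
           ⇒ₜ (p₀ ⇔ₜ ¬ₜ p₅))
        (⟨ Γ′ ⊓f Δ′ ⟩f ψ ∷ ⟨ Γ′ ⟩f ψ ∷ ⟨ Δ′ ⟩f ψ ∷ ⟨ Γ ⟩f ¬f ψ ∷ ⟨ Δ ⟩f ¬f ψ
          ∷ ⟨ Γ ⊔f Δ ⟩f ¬f ψ ∷ [])
    ⊙ ax-cap Γ′ Δ′ ψ ⊙ dualΓ ψ ⊙ dualΔ ψ ⊙ ax-cup Γ Δ (¬f ψ)

-- ⟨Γ′^×⟩ψ → ¬⟨Γ^*⟩¬ψ by induction on the star, with ¬⟨Γ′^×⟩ψ as invariant.
dual-×*-⇒ : ∀ {Γ′ Γ} → Dual Γ′ Γ → ∀ ψ → Full⊢ (⟨ Γ′ ×f ⟩f ψ ⇒f ¬f ⟨ Γ *f ⟩f ¬f ψ)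
dual-×*-⇒ {Γ′} {Γ} dual ψ =
  tauto ((p₁ ⇒ₜ ¬ₜ p₀) ⇒ₜ (p₂ ⇒ₜ p₁) ⇒ₜ p₀ ⇒ₜ ¬ₜ p₂)
        (A ∷ ⟨ Γ *f ⟩f ¬f A ∷ ⟨ Γ *f ⟩f ¬f ψ ∷ [])
    ⊙ star-ind invariant ⊙ mono (Γ *f) ¬ψ⇒¬A
  where
  A = ⟨ Γ′ ×f ⟩f ψ
  invariant : Full⊢ (⟨ Γ ⟩f ¬f A ⇒f ¬f A)
  invariant = tauto ((p₀ ⇔ₜ p₁ ∧ₜ p₂) ⇒ₜ (p₂ ⇔ₜ ¬ₜ p₃) ⇒ₜ p₃ ⇒ₜ ¬ₜ p₀)
                    (A ∷ ψ ∷ ⟨ Γ′ ⟩f A ∷ ⟨ Γ ⟩f ¬f A ∷ [])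
                ⊙ ax-cross Γ′ ψ ⊙ dual A
  ¬ψ⇒¬A : Full⊢ (¬f ψ ⇒f ¬f A)
  ¬ψ⇒¬A = tauto ((p₀ ⇔ₜ p₁ ∧ₜ p₂) ⇒ₜ ¬ₜ p₁ ⇒ₜ ¬ₜ p₀) (A ∷ ψ ∷ ⟨ Γ′ ⟩f A ∷ [])
            ⊙ ax-cross Γ′ ψ

-- ¬⟨Γ^*⟩¬ψ → ⟨Γ′^×⟩ψ by coinduction on the cross, ¬⟨Γ^*⟩¬ψ being a post-fixpoint of ⟨Γ′⟩.
dual-×*-⇐ : ∀ {Γ′ Γ} → Dual Γ′ Γ → ∀ ψ → Full⊢ (¬f ⟨ Γ *f ⟩f ¬f ψ ⇒f ⟨ Γ′ ×f ⟩f ψ)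
dual-×*-⇐ {Γ′} {Γ} dual ψ = ⇒-trans (cross-coind postFixpoint) (mono (Γ′ ×f) N⇒ψ)
  where
  S = ⟨ Γ *f ⟩f ¬f ψ
  N = ¬f S
  postFixpoint : Full⊢ (N ⇒f ⟨ Γ′ ⟩f N)
  postFixpoint =
    tauto ((p₀ ⇔ₜ ¬ₜ p₁ ∨ₜ p₂) ⇒ₜ (p₃ ⇔ₜ ¬ₜ p₄) ⇒ₜ (p₄ ⇔ₜ p₂) ⇒ₜ ¬ₜ p₀ ⇒ₜ p₃)
          (S ∷ ψ ∷ ⟨ Γ ⟩f S ∷ ⟨ Γ′ ⟩f N ∷ ⟨ Γ ⟩f ¬f N ∷ [])
      ⊙ ax-star Γ (¬f ψ) ⊙ dual N ⊙ ⟨⟩-cong Γ (¬¬-elim S)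
  N⇒ψ : Full⊢ (N ⇒f ψ)
  N⇒ψ = tauto ((p₀ ⇔ₜ ¬ₜ p₁ ∨ₜ p₂) ⇒ₜ ¬ₜ p₀ ⇒ₜ p₁) (S ∷ ψ ∷ ⟨ Γ ⟩f S ∷ [])
          ⊙ ax-star Γ (¬f ψ)

dual-×* : ∀ {Γ′ Γ} → Dual Γ′ Γ → Dual (Γ′ ×f) (Γ *f)
dual-×* dual ψ = ⇔-intro (dual-×*-⇒ dual ψ) (dual-×*-⇐ dual ψ)

dual-!? : ∀ {χ′ χ} → Full⊢ (χ′ ⇔f ¬f χ) → Dual (χ′ !f) (χ ?f)
dual-!? {χ′} {χ} χ′⇔¬χ ψ =
  tauto ((p₀ ⇔ₜ p₂ ∨ₜ p₄) ⇒ₜ (p₁ ⇔ₜ p₃ ∧ₜ ¬ₜ p₄) ⇒ₜ (p₂ ⇔ₜ ¬ₜ p₃) ⇒ₜ (p₀ ⇔ₜ ¬ₜ p₁))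
        (⟨ χ′ !f ⟩f ψ ∷ ⟨ χ ?f ⟩f ¬f ψ ∷ χ′ ∷ χ ∷ ψ ∷ [])
    ⊙ ax-bang χ′ ψ ⊙ ax-test χ (¬f ψ) ⊙ χ′⇔¬χ

⇔¬-sym : ∀ {a b} → Full⊢ (a ⇔f ¬f b) → Full⊢ (b ⇔f ¬f a)
⇔¬-sym {a} {b} a⇔¬b = tauto ((p₀ ⇔ₜ ¬ₜ p₁) ⇒ₜ (p₁ ⇔ₜ ¬ₜ p₀)) (a ∷ b ∷ []) ⊙ a⇔¬b

comp-negates : (φ : NFForm) → Full⊢ (embF (comp φ) ⇔f ¬f embF φ)
comp-dual : (γ : NFGame) → Dual (embG (comp γ)) (embG γ)

comp-negates (pos p) = tauto (¬ₜ p₀ ⇔ₜ ¬ₜ p₀) (var p ∷ [])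
comp-negates (neg p) = tauto (p₀ ⇔ₜ ¬ₜ ¬ₜ p₀) (var p ∷ [])
comp-negates (φ ∨ₙ ψ) =
  tauto ((p₀ ⇔ₜ ¬ₜ p₁) ⇒ₜ (p₂ ⇔ₜ ¬ₜ p₃) ⇒ₜ (p₀ ∧ₜ p₂ ⇔ₜ ¬ₜ (p₁ ∨ₜ p₃)))
        (embF (comp φ) ∷ embF φ ∷ embF (comp ψ) ∷ embF ψ ∷ [])
    ⊙ comp-negates φ ⊙ comp-negates ψ
comp-negates (φ ∧ₙ ψ) =
  tauto ((p₀ ⇔ₜ ¬ₜ p₁) ⇒ₜ (p₂ ⇔ₜ ¬ₜ p₃) ⇒ₜ (p₀ ∨ₜ p₂ ⇔ₜ ¬ₜ (p₁ ∧ₜ p₃)))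
        (embF (comp φ) ∷ embF φ ∷ embF (comp ψ) ∷ embF ψ ∷ [])
    ⊙ comp-negates φ ⊙ comp-negates ψ
comp-negates (⟨ γ ⟩ₙ φ) =
  tauto ((p₀ ⇔ₜ ¬ₜ p₁) ⇒ₜ (p₂ ⇔ₜ p₁) ⇒ₜ (p₀ ⇔ₜ ¬ₜ p₂))
        (⟨ embG (comp γ) ⟩f embF (comp φ) ∷ ⟨ embG γ ⟩f ¬f embF (comp φ)
          ∷ ⟨ embG γ ⟩f embF φ ∷ [])
    ⊙ comp-dual γ (embF (comp φ)) ⊙ ⟨⟩-cong (embG γ) (⇔¬-sym (comp-negates φ))

comp-dual (atg g)    = ax-dual (gat g)
comp-dual (datg g)   = dual-sym (ax-dual (gat g))
comp-dual (γ ⨾ₙ δ)   = dual-⨾ (comp-dual γ) (comp-dual δ)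
comp-dual (γ ⊔ₙ δ)   = dual-⊓⊔ (comp-dual γ) (comp-dual δ)
comp-dual (γ ⊓ₙ δ)   = dual-sym (dual-⊓⊔ (dual-sym (comp-dual γ)) (dual-sym (comp-dual δ)))
comp-dual (starₙ γ)  = dual-×* (comp-dual γ)
comp-dual (crossₙ γ) = dual-sym (dual-×* (dual-sym (comp-dual γ)))
comp-dual (testₙ φ)  = dual-!? (comp-negates φ)
comp-dual (bangₙ φ)  = dual-sym (dual-!? (⇔¬-sym (comp-negates φ)))

-- Monotonicity

infix 4 _⊑_ _⊑ₙ_

_⊑_ : FGm → FGm → Set
Γ ⊑ Δ = ∀ ψ → Full⊢ (⟨ Γ ⟩f ψ ⇒f ⟨ Δ ⟩f ψ)

⊑-refl : ∀ {Γ} → Γ ⊑ Γ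
⊑-refl _ = ⇒-refl

⨾-mono : ∀ {Γ Γ′ Δ Δ′} → Γ ⊑ Γ′ → Δ ⊑ Δ′ → Γ ⨾f Δ ⊑ Γ′ ⨾f Δ′
⨾-mono {Γ} {Γ′} {Δ} {Δ′} Γ⊑Γ′ Δ⊑Δ′ ψ =
  ⇒-resp-⇔ (ax-seq Γ Δ ψ) (ax-seq Γ′ Δ′ ψ)
           (⇒-trans (mono Γ (Δ⊑Δ′ ψ)) (Γ⊑Γ′ (⟨ Δ′ ⟩f ψ)))

⊔-mono : ∀ {Γ Γ′ Δ Δ′} → Γ ⊑ Γ′ → Δ ⊑ Δ′ → Γ ⊔f Δ ⊑ Γ′ ⊔f Δ′
⊔-mono {Γ} {Γ′} {Δ} {Δ′} Γ⊑Γ′ Δ⊑Δ′ ψ =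
  ⇒-resp-⇔ (ax-cup Γ Δ ψ) (ax-cup Γ′ Δ′ ψ) (∨-mono (Γ⊑Γ′ ψ) (Δ⊑Δ′ ψ))

⊓-mono : ∀ {Γ Γ′ Δ Δ′} → Γ ⊑ Γ′ → Δ ⊑ Δ′ → Γ ⊓f Δ ⊑ Γ′ ⊓f Δ′
⊓-mono {Γ} {Γ′} {Δ} {Δ′} Γ⊑Γ′ Δ⊑Δ′ ψ =
  ⇒-resp-⇔ (ax-cap Γ Δ ψ) (ax-cap Γ′ Δ′ ψ) (∧-mono (Γ⊑Γ′ ψ) (Δ⊑Δ′ ψ))

-- ⟨Δ^*⟩ψ is closed under ⟨Γ⟩, so it bounds the least fixpoint ⟨Γ^*⟩ψ.
*-mono : ∀ {Γ Δ} → Γ ⊑ Δ → Γ *f ⊑ Δ *f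
*-mono {Γ} {Δ} Γ⊑Δ ψ = ⇒-trans (mono (Γ *f) ψ⇒S) (star-ind closed)
  where
  S = ⟨ Δ *f ⟩f ψ
  closed : Full⊢ (⟨ Γ ⟩f S ⇒f S)
  closed = tauto ((p₀ ⇒ₜ p₁) ⇒ₜ (p₂ ⇔ₜ p₃ ∨ₜ p₁) ⇒ₜ p₀ ⇒ₜ p₂)
                 (⟨ Γ ⟩f S ∷ ⟨ Δ ⟩f S ∷ S ∷ ψ ∷ [])
             ⊙ Γ⊑Δ S ⊙ ax-star Δ ψ
  ψ⇒S : Full⊢ (ψ ⇒f S)
  ψ⇒S = tauto ((p₀ ⇔ₜ p₁ ∨ₜ p₂) ⇒ₜ p₁ ⇒ₜ p₀) (S ∷ ψ ∷ ⟨ Δ ⟩f S ∷ []) ⊙ ax-star Δ ψ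

-- Dually, ⟨Γ^×⟩ψ is a post-fixpoint of ⟨Δ⟩, so the greatest fixpoint ⟨Δ^×⟩ψ bounds it.
×-mono : ∀ {Γ Δ} → Γ ⊑ Δ → Γ ×f ⊑ Δ ×f
×-mono {Γ} {Δ} Γ⊑Δ ψ = ⇒-trans (cross-coind postFixpoint) (mono (Δ ×f) X⇒ψ)
  where
  X = ⟨ Γ ×f ⟩f ψ
  postFixpoint : Full⊢ (X ⇒f ⟨ Δ ⟩f X)
  postFixpoint = tauto ((p₀ ⇔ₜ p₁ ∧ₜ p₂) ⇒ₜ (p₂ ⇒ₜ p₃) ⇒ₜ p₀ ⇒ₜ p₃)
                       (X ∷ ψ ∷ ⟨ Γ ⟩f X ∷ ⟨ Δ ⟩f X ∷ [])
                   ⊙ ax-cross Γ ψ ⊙ Γ⊑Δ X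
  X⇒ψ : Full⊢ (X ⇒f ψ)
  X⇒ψ = tauto ((p₀ ⇔ₜ p₁ ∧ₜ p₂) ⇒ₜ p₀ ⇒ₜ p₁) (X ∷ ψ ∷ ⟨ Γ ⟩f X ∷ []) ⊙ ax-cross Γ ψ

?-mono : ∀ {χ χ′} → Full⊢ (χ ⇒f χ′) → χ ?f ⊑ χ′ ?f
?-mono {χ} {χ′} χ⇒χ′ ψ = ⇒-resp-⇔ (ax-test χ ψ) (ax-test χ′ ψ) (∧-mono χ⇒χ′ ⇒-refl)

!-mono : ∀ {χ χ′} → Full⊢ (χ ⇒f χ′) → χ !f ⊑ χ′ !f
!-mono {χ} {χ′} χ⇒χ′ ψ = ⇒-resp-⇔ (ax-bang χ ψ) (ax-bang χ′ ψ) (∨-mono χ⇒χ′ ⇒-refl)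

_⊑ₙ_ : ∀ {s} → NF s → NF s → Set
_⊑ₙ_ {fm} φ ψ = Full⊢ (embF φ ⇒f embF ψ)
_⊑ₙ_ {gm} γ δ = embG γ ⊑ embG δ

plug-mono : ∀ {h t} (c : Ctx h t) {a b : NF h} → a ⊑ₙ b → plug c a ⊑ₙ plug c b
plug-mono hole       a⊑b = a⊑b
plug-mono (∨L c ψ)   a⊑b = ∨-mono (plug-mono c a⊑b) ⇒-refl
plug-mono (∨R φ c)   a⊑b = ∨-mono ⇒-refl (plug-mono c a⊑b)
plug-mono (∧L c ψ)   a⊑b = ∧-mono (plug-mono c a⊑b) ⇒-refl
plug-mono (∧R φ c)   a⊑b = ∧-mono ⇒-refl (plug-mono c a⊑b)
plug-mono (⟨⟩G c φ)  a⊑b = plug-mono c a⊑b (embF φ)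
plug-mono (⟨⟩F γ c)  a⊑b = mono (embG γ) (plug-mono c a⊑b)
plug-mono (⨾L c δ)   a⊑b = ⨾-mono (plug-mono c a⊑b) ⊑-refl
plug-mono (⨾R γ c)   a⊑b = ⨾-mono ⊑-refl (plug-mono c a⊑b)
plug-mono (⊔L c δ)   a⊑b = ⊔-mono (plug-mono c a⊑b) ⊑-refl
plug-mono (⊔R γ c)   a⊑b = ⊔-mono ⊑-refl (plug-mono c a⊑b)
plug-mono (⊓L c δ)   a⊑b = ⊓-mono (plug-mono c a⊑b) ⊑-refl
plug-mono (⊓R γ c)   a⊑b = ⊓-mono ⊑-refl (plug-mono c a⊑b)
plug-mono (starC c)  a⊑b = *-mono (plug-mono c a⊑b)
plug-mono (crossC c) a⊑b = ×-mono (plug-mono c a⊑b)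
plug-mono (testC c)  a⊑b = ?-mono (plug-mono c a⊑b)
plug-mono (bangC c)  a⊑b = !-mono (plug-mono c a⊑b)

-- Sequents

⋁-,, : ∀ Φ x → Full⊢ (⋁ (Φ ,, x) ⇔f (⋁ Φ ∨f embF x))
⋁-,, []          x = tauto (p₁ ⇔ₜ ¬ₜ (p₀ ∨ₜ ¬ₜ p₀) ∨ₜ p₁) (var 0 ∷ embF x ∷ [])
⋁-,, (φ ∷ [])    x = ⇔-intro ⇒-refl ⇒-refl
⋁-,, (φ ∷ ψ ∷ Φ) x =
  tauto ((p₁ ⇔ₜ p₂ ∨ₜ p₃) ⇒ₜ (p₀ ∨ₜ p₁ ⇔ₜ (p₀ ∨ₜ p₂) ∨ₜ p₃))
        (embF φ ∷ ⋁ ((ψ ∷ Φ) ,, x) ∷ ⋁ (ψ ∷ Φ) ∷ embF x ∷ [])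
    ⊙ ⋁-,, (ψ ∷ Φ) x

compSeq-negates : ∀ Φ → Full⊢ (embF (compSeq Φ) ⇔f ¬f ⋁ Φ)
compSeq-negates []          = tauto (p₀ ∨ₜ ¬ₜ p₀ ⇔ₜ ¬ₜ ¬ₜ (p₀ ∨ₜ ¬ₜ p₀)) (var 0 ∷ [])
compSeq-negates (φ ∷ [])    = comp-negates φ
compSeq-negates (φ ∷ ψ ∷ Φ) =
  tauto ((p₀ ⇔ₜ ¬ₜ p₁) ⇒ₜ (p₂ ⇔ₜ ¬ₜ p₃) ⇒ₜ (p₀ ∧ₜ p₂ ⇔ₜ ¬ₜ (p₁ ∨ₜ p₃)))
        (embF (comp φ) ∷ embF φ ∷ embF (compSeq (ψ ∷ Φ)) ∷ ⋁ (ψ ∷ Φ) ∷ [])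
    ⊙ comp-negates φ ⊙ compSeq-negates (ψ ∷ Φ)

⋁-,,⇔compSeq-⇒ : ∀ Φ {x} → Full⊢ (⋁ (Φ ,, x)) ⇔ Full⊢ (embF (compSeq Φ) ⇒f embF x)
⋁-,,⇔compSeq-⇒ Φ {x} = mk⇔
  (λ ⊢Φ,x → template₁ ⊙ ⊢Φ,x ⊙ ⋁-,, Φ x ⊙ compSeq-negates Φ)
  (λ Φ̄⇒x → template₂ ⊙ Φ̄⇒x ⊙ ⋁-,, Φ x ⊙ compSeq-negates Φ)
  where
  σ = ⋁ (Φ ,, x) ∷ ⋁ Φ ∷ embF x ∷ embF (compSeq Φ) ∷ []
  template₁ = tauto (p₀ ⇒ₜ (p₀ ⇔ₜ p₁ ∨ₜ p₂) ⇒ₜ (p₃ ⇔ₜ ¬ₜ p₁) ⇒ₜ p₃ ⇒ₜ p₂) σ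
  template₂ = tauto ((p₃ ⇒ₜ p₂) ⇒ₜ (p₀ ⇔ₜ p₁ ∨ₜ p₂) ⇒ₜ (p₃ ⇔ₜ ¬ₜ p₁) ⇒ₜ p₀) σ

⋁-,,-mono : ∀ Φ {x y} → Full⊢ (embF x ⇒f embF y) → Full⊢ (⋁ (Φ ,, x)) → Full⊢ (⋁ (Φ ,, y))
⋁-,,-mono Φ x⇒y ⊢Φ,x =
  from (⋁-,,⇔compSeq-⇒ Φ) (⇒-trans (to (⋁-,,⇔compSeq-⇒ Φ) ⊢Φ,x) x⇒y)

⋁-true⇒Any : ∀ v Φ → T (evalT v (⋁ Φ)) → Any (T ∘ evalT v ∘ embF) Φ
⋁-true⇒Any v [] ⊥-true with v (var 0)
... | true  = ⊥-elim ⊥-true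
... | false = ⊥-elim ⊥-true
⋁-true⇒Any v (φ ∷ [])    φ-true = here φ-true
⋁-true⇒Any v (φ ∷ ψ ∷ Φ) ⋁-true = [ here , there ∘ ⋁-true⇒Any v (ψ ∷ Φ) ]′ (to T-∨ ⋁-true)

Any⇒⋁-true : ∀ v {Φ} → Any (T ∘ evalT v ∘ embF) Φ → T (evalT v (⋁ Φ))
Any⇒⋁-true v {_ ∷ []}    (here φ-true) = φ-true
Any⇒⋁-true v {_ ∷ []}    (there ())
Any⇒⋁-true v {_ ∷ _ ∷ _} (here φ-true) = from T-∨ (inj₁ φ-true)
Any⇒⋁-true v {_ ∷ _ ∷ _} (there any)   = from T-∨ (inj₂ (Any⇒⋁-true v any))

⋁-⊆ : ∀ {Φ Ψ} → Φ ⊆ Ψ → Full⊢ (⋁ Φ ⇒f ⋁ Ψ)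
⋁-⊆ {Φ} Φ⊆Ψ = taut λ v → implication-true (Any⇒⋁-true v ∘ Any-resp-⊆ Φ⊆Ψ ∘ ⋁-true⇒Any v Φ)
  where
  implication-true : ∀ {x y} → (T x → T y) → not x ∨ y ≡ true
  implication-true {false} _   = refl
  implication-true {true}  x→y = to T-≡ (x→y _)

-- Soundness

-- X = ⟨(B!;Γ)^×⟩⟨B!⟩F unfolds to (B ∨ F) ∧ (B ∨ ⟨Γ⟩X); where B fails, X already gives
-- F ∧ ⟨Γ⟩X, and where B holds the hypothesis does.  So X ⇒ F ∧ ⟨Γ⟩X, and coinduction
-- yields X ⇒ ⟨Γ^×⟩F, while B ⇒ X is immediate from the unfolding.
focused-cross-coind : ∀ {B F Γ} →
  Full⊢ (B ⇒f F ∧f ⟨ Γ ⟩f ⟨ (B !f ⨾f Γ) ×f ⟩f ⟨ B !f ⟩f F) → Full⊢ (B ⇒f ⟨ Γ ×f ⟩f F)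
focused-cross-coind {B} {F} {Γ} premise =
  tauto ((p₁ ⇔ₜ (p₀ ∨ₜ p₂) ∧ₜ (p₀ ∨ₜ p₃)) ⇒ₜ (p₁ ⇒ₜ p₄) ⇒ₜ (p₄ ⇒ₜ p₅) ⇒ₜ p₀ ⇒ₜ p₅)
        (B ∷ X ∷ F ∷ ⟨ Γ ⟩f X ∷ ⟨ Γ ×f ⟩f X ∷ ⟨ Γ ×f ⟩f F ∷ [])
    ⊙ unfold ⊙ cross-coind X⇒⟨Γ⟩X ⊙ mono (Γ ×f) X⇒F
  where
  X = ⟨ (B !f ⨾f Γ) ×f ⟩f ⟨ B !f ⟩f F
  σ = B ∷ X ∷ F ∷ ⟨ Γ ⟩f X ∷ []
  unfold : Full⊢ (X ⇔f (B ∨f F) ∧f (B ∨f ⟨ Γ ⟩f X))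
  unfold =
    tauto ((p₀ ⇔ₜ p₁ ∧ₜ p₂) ⇒ₜ (p₂ ⇔ₜ p₃) ⇒ₜ (p₃ ⇔ₜ p₄ ∨ₜ p₅) ⇒ₜ (p₁ ⇔ₜ p₄ ∨ₜ p₆)
             ⇒ₜ (p₀ ⇔ₜ (p₄ ∨ₜ p₆) ∧ₜ (p₄ ∨ₜ p₅)))
          (X ∷ ⟨ B !f ⟩f F ∷ ⟨ B !f ⨾f Γ ⟩f X ∷ ⟨ B !f ⟩f ⟨ Γ ⟩f X ∷ B ∷ ⟨ Γ ⟩f X ∷ F ∷ [])
      ⊙ ax-cross (B !f ⨾f Γ) (⟨ B !f ⟩f F) ⊙ ax-seq (B !f) Γ X
      ⊙ ax-bang B (⟨ Γ ⟩f X) ⊙ ax-bang B F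
  X⇒F : Full⊢ (X ⇒f F)
  X⇒F = tauto ((p₀ ⇒ₜ p₂ ∧ₜ p₃) ⇒ₜ (p₁ ⇔ₜ (p₀ ∨ₜ p₂) ∧ₜ (p₀ ∨ₜ p₃)) ⇒ₜ p₁ ⇒ₜ p₂) σ
          ⊙ premise ⊙ unfold
  X⇒⟨Γ⟩X : Full⊢ (X ⇒f ⟨ Γ ⟩f X)
  X⇒⟨Γ⟩X = tauto ((p₀ ⇒ₜ p₂ ∧ₜ p₃) ⇒ₜ (p₁ ⇔ₜ (p₀ ∨ₜ p₂) ∧ₜ (p₀ ∨ₜ p₃)) ⇒ₜ p₁ ⇒ₜ p₃) σ
             ⊙ premise ⊙ unfold

!-inflationary : ∀ χ φ → Full⊢ (φ ⇒f ⟨ χ !f ⟩f φ)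
!-inflationary χ φ = ⇒-trans (tauto (p₁ ⇒ₜ p₀ ∨ₜ p₁) (χ ∷ φ ∷ [])) (⇔-from (ax-bang χ φ))

!⨾-inflationary : ∀ χ Γ → Γ ⊑ χ !f ⨾f Γ
!⨾-inflationary χ Γ ψ = ⇒-trans (!-inflationary χ (⟨ Γ ⟩f ψ)) (⇔-from (ax-seq (χ !f) Γ ψ))

soundness : ∀ {Φ} → G⊢ Φ → Full⊢ (⋁ Φ)
soundness (set-eq ⊢Φ (Φ⊆Ψ , _)) = ⋁-⊆ (Φ⊆Ψ _) ⊙ soundness ⊢Φ
soundness (ax Φ) = from (⋁-,,⇔compSeq-⇒ Φ) ⇒-refl
soundness (weak {Φ} φ ⊢Φ) =
  tauto (p₀ ⇒ₜ (p₁ ⇔ₜ p₀ ∨ₜ p₂) ⇒ₜ p₁) (⋁ Φ ∷ ⋁ (Φ ,, φ) ∷ embF φ ∷ [])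
    ⊙ soundness ⊢Φ ⊙ ⋁-,, Φ φ
soundness (modal g {φ} {ψ} ⊢φ,ψ) =
  tauto ((p₀ ⇒ₜ p₁) ⇒ₜ (p₂ ⇔ₜ ¬ₜ p₀) ⇒ₜ p₁ ∨ₜ p₂)
        (⟨ gat g ⟩f ¬f embF ψ ∷ ⟨ gat g ⟩f embF φ ∷ ⟨ gat g ᵈf ⟩f embF ψ ∷ [])
    ⊙ mono (gat g) (tauto (p₀ ∨ₜ p₁ ⇒ₜ ¬ₜ p₁ ⇒ₜ p₀) (embF φ ∷ embF ψ ∷ []) ⊙ soundness ⊢φ,ψ)
    ⊙ ax-dual (gat g) (embF ψ)
soundness (or-r {Φ} {φ} {ψ} ⊢Φ,φ,ψ) =
  tauto (p₀ ⇒ₜ (p₀ ⇔ₜ p₁ ∨ₜ p₃) ⇒ₜ (p₁ ⇔ₜ p₄ ∨ₜ p₂) ⇒ₜ (p₅ ⇔ₜ p₄ ∨ₜ (p₂ ∨ₜ p₃)) ⇒ₜ p₅)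
        (⋁ (Φ ,, φ ,, ψ) ∷ ⋁ (Φ ,, φ) ∷ embF φ ∷ embF ψ ∷ ⋁ Φ ∷ ⋁ (Φ ,, (φ ∨ₙ ψ)) ∷ [])
    ⊙ soundness ⊢Φ,φ,ψ ⊙ ⋁-,, (Φ ,, φ) ψ ⊙ ⋁-,, Φ φ ⊙ ⋁-,, Φ (φ ∨ₙ ψ)
soundness (and-r {Φ} {φ} {ψ} ⊢Φ,φ ⊢Φ,ψ) =
  from (⋁-,,⇔compSeq-⇒ Φ)
    (tauto ((p₀ ⇒ₜ p₁) ⇒ₜ (p₀ ⇒ₜ p₂) ⇒ₜ p₀ ⇒ₜ p₁ ∧ₜ p₂)
           (embF (compSeq Φ) ∷ embF φ ∷ embF ψ ∷ [])
       ⊙ to (⋁-,,⇔compSeq-⇒ Φ) (soundness ⊢Φ,φ) ⊙ to (⋁-,,⇔compSeq-⇒ Φ) (soundness ⊢Φ,ψ))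
soundness (star-r {Φ} {γ} {φ} premise) =
  ⋁-,,-mono Φ (⇔-from (ax-star (embG γ) (embF φ))) (soundness premise)
soundness (cross-r {Φ} {γ} {φ} premise) =
  ⋁-,,-mono Φ (⇔-from (ax-cross (embG γ) (embF φ))) (soundness premise)
soundness (cup-r {Φ} {γ} {δ} {φ} premise) =
  ⋁-,,-mono Φ (⇔-from (ax-cup (embG γ) (embG δ) (embF φ))) (soundness premise)
soundness (cap-r {Φ} {γ} {δ} {φ} premise) =
  ⋁-,,-mono Φ (⇔-from (ax-cap (embG γ) (embG δ) (embF φ))) (soundness premise)
soundness (test-r {Φ} {ψ} {φ} premise) =
  ⋁-,,-mono Φ (⇔-from (ax-test (embF ψ) (embF φ))) (soundness premise)
soundness (bang-r {Φ} {ψ} {φ} premise) =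
  ⋁-,,-mono Φ (⇔-from (ax-bang (embF ψ) (embF φ))) (soundness premise)
soundness (deep-bang-g {Φ} c χ γ premise) =
  ⋁-,,-mono Φ (plug-mono c (!⨾-inflationary (embF χ) (embG γ))) (soundness premise)
soundness (deep-bang-f {Φ} c χ φ premise) =
  ⋁-,,-mono Φ (plug-mono c (!-inflationary (embF χ) (embF φ))) (soundness premise)
soundness (deep-seq {Φ} c γ δ φ premise) =
  ⋁-,,-mono Φ (plug-mono c (⇔-from (ax-seq (embG γ) (embG δ) (embF φ)))) (soundness premise)
soundness (cross-focus {Φ} premise) =
  from (⋁-,,⇔compSeq-⇒ Φ) (focused-cross-coind (to (⋁-,,⇔compSeq-⇒ Φ) (soundness premise)))

proposition7 : ((Φ : Sequent) → G⊢ Φ → Full⊢ (⋁ Φ))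
                 × ((ξ : NFForm) → G⊢ (ξ ∷ []) → Full⊢ (embF ξ))
proposition7 = (λ _ → soundness) , (λ _ → soundness)
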